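{- Let $P$ be a (possibly disjunctive) answer set program and let $M\subseteq \mathrm{at}(P)$ be an interpretation such that $\tau_M\models\mathrm{Comp}(P)$. Then $M$ is an answer set of $P$ if and only if the propositional formula $$\mathrm{UP}(\mathrm{Copy}(P),\tau_M)\ \wedge \bigvee_{x\in M\cap \mathrm{LA}(P)} \neg x'$$ is unsatisfiable.
   Context: A program $P$ is a finite set of rules $r$ of the form $a_1 \vee \dots \vee a_k \leftarrow b_1, \dots, b_m, \mathsf{not}\ c_1, \dots, \mathsf{not}\ c_n$ ($k,m,n \ge 0$) over propositional atoms; $\mathrm{head}(r)=\{a_1,\dots,a_k\}$, $\mathrm{body}(r)^+=\{b_1,\dots,b_m\}$, $\mathrm{body}(r)^-=\{c_1,\dots,c_n\}$, and $\mathrm{body}(r)$ is the set of literals $\{b_1,\dots,b_m,\neg c_1,\dots,\neg c_n\}$. $\mathrm{at}(P)$ is the set of atoms of $P$. An interpretation is $M \subseteq \mathrm{at}(P)$; $\tau_M$ is the assignment on $\mathrm{at}(P)$ with $\tau_M(x)=1$ iff $x\in M$. $M \models r$ iff $(\mathrm{head}(r)\cup\mathrm{body}(r)^-)\cap M \neq\emptyset$ or $\mathrm{body}(r)^+\setminus M\neq\emptyset$; $M\models P$ iff $M \models r$ for all rules. The reduct is $P^M=\{\mathrm{head}(r)\leftarrow \mathrm{body}(r)^+ \mid r\in P,\ \mathrm{body}(r)^-\cap M=\emptyset\}$. $M$ is an answer set iff $M\models P$ and there is no $M'\subsetneq M$ with $M'\models P^M$. An empty disjunction is false. The Clark completion $\mathrm{Comp}(P)$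 is the propositional formula over $\mathrm{at}(P)$ that is the conjunction of: (1) $\neg a$ for each atom $a$ occurring in no rule head; (2) for each rule $r$, $\bigwedge_{\ell\in\mathrm{body}(r)}\ell \rightarrow \bigvee_{x\in\mathrm{head}(r)} x$; (3) for each atom $a$ occurring in some head, with $r_1,\dots,r_k$ all rules having $a$ in the head, $a \rightarrow \bigvee_{i=1}^k\big(\bigwedge_{\ell\in\mathrm{body}(r_i)}\ell \wedge \bigwedge_{x\in\mathrm{head}(r_i)\setminus\{a\}}\neg x\big)$. The positive dependency graph of $P$ has vertex set $\mathrm{at}(P)$ and an edge from $y$ to $x$ whenever some rule $r$ has $x\in\mathrm{body}(r)^+$ and $y\in\mathrm{head}(r)$. A set $L\subseteq \mathrm{at}(P)$ is a loop if for all $x,y\in L$ there is a non-empty directed path from $x$ to $y$ all of whose vertices lie in $L$; $\mathrm{LA}(P)$ (loop atoms) is the set of atoms belonging to some loop. $\mathrm{Copy}(P)$: for each $x\in\mathrm{LA}(P)$ introduce a fresh variable $x'\notin\mathrm{at}(P)$. $\mathrm{Copy}(P)$ is the CNF (set of clauses) given by: (type 1) $x'\rightarrow x$ for every $x\in\mathrm{LA}(P)$; (type 2) for each rule $r=a_1\vee\dots\vee a_k\leftarrow b_1,\dots,b_m,\mathsf{not}\ c_1,\dots,\mathsf{not}\ c_n$ with $\mathrm{head}(r)\cap\mathrm{LA}(P)\neq\emptyset$, the implication $f(b_1)\wedge\dots\wedge f(b_m)\wedge\neg c_1\wedge\dots\wedge\neg c_n\rightarrow f(a_1)\vee\dots\vee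 f(a_k)$, where $f(x)=x'$ if $x\in\mathrm{LA}(P)$ and $f(x)=x$ otherwise. Unit propagation: for a CNF $\phi$ (set of clauses) and an assignment $\tau$ to a subset of its variables (with $\tau(\neg x)=1-\tau(x)$), $\mathrm{UP}(\phi,\tau)$ is obtained by repeatedly applying, until no syntactic change occurs: (a) remove every clause containing a literal $\ell$ with $\tau(\ell)=1$; (b) remove from every clause each literal $\ell$ such that $\tau(\ell)=0$ or the unit clause $\{\neg\ell\}$ is present. The unit propagation of the empty formula is empty. -}

module Defs where

open import Data.Nat using (ℕ; zero; suc; _+_) renaming (_≡ᵇ_ to _==ℕ_)
open import Data.Nat.Properties using (_≟_)
open import Data.Bool using (Bool; true; false; not; _∧_; _∨_; if_then_else_)
open import Data.Maybe using (Maybe; just; nothing)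
open import Data.List using (List; []; _∷_; [_]; _++_; map; concatMap; foldr; filterᵇ; length)
open import Data.Bool.ListAction using (any)
open import Data.Nat.ListAction using (sum)
open import Data.List.Membership.Propositional using (_∈_; _∉_)
open import Data.List.Membership.DecPropositional _≟_ using (_∈?_)
open import Data.List.Relation.Unary.All using (All)
open import Data.List.Relation.Unary.Any using (Any)
open import Data.Product using (Σ; ∃; _×_; _,_)
open import Data.Sum using (_⊎_)
open import Relation.Nullary using (¬_; does)
open import Relation.Binary.PropositionalEquality using (_≡_)
open import Function using (_∘_; id)

record Rule : Set where
  constructor mkRule
  field
    head : List ℕ
    pos  : List ℕ
    neg  : List ℕ
open Rule public

Program : Set
Program = List Rule

memb : ℕ → List ℕ → Bool
memb x xs = does (x ∈? xs)

at : Program → List ℕ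
at P = concatMap (λ r → head r ++ pos r ++ neg r) P

_⊆_ : List ℕ → List ℕ → Set
A ⊆ B = All (λ x → x ∈ B) A

_⊨r_ : List ℕ → Rule → Set
M ⊨r r = Any (λ a → a ∈ M) (head r ++ neg r) ⊎ Any (λ b → b ∉ M) (pos r)

_⊨_ : List ℕ → Program → Set
M ⊨ P = All (M ⊨r_) P

reduct : Program → List ℕ → Program
reduct P M =
  map (λ r → mkRule (head r) (pos r) [])
      (filterᵇ (λ r → not (any (λ c → memb c M) (neg r))) P)

AnswerSet : Program → List ℕ → Set
AnswerSet P M =
  M ⊨ P × ¬ (Σ (List ℕ) λ M' → M' ⊆ M × Any (λ x → x ∉ M') M × M' ⊨ reduct P M)

data Form : Set where
  var  : ℕ → Form
  ¬f_  : Form → Form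
  _∧f_ : Form → Form → Form
  _∨f_ : Form → Form → Form
  _⇒f_ : Form → Form → Form
  ⊤f   : Form
  ⊥f   : Form

eval : (ℕ → Bool) → Form → Bool
eval τ (var x)   = τ x
eval τ (¬f φ)    = not (eval τ φ)
eval τ (φ ∧f ψ)  = eval τ φ ∧ eval τ ψ
eval τ (φ ∨f ψ)  = eval τ φ ∨ eval τ ψ
eval τ (φ ⇒f ψ)  = not (eval τ φ) ∨ eval τ ψ
eval τ ⊤f        = true
eval τ ⊥f        = false

bigAnd : List Form → Form
bigAnd = foldr _∧f_ ⊤f

bigOr : List Form → Form
bigOr = foldr _∨f_ ⊥f

bodyF : Rule → Form
bodyF r = bigAnd (map var (pos r) ++ map (¬f_ ∘ var) (neg r))

headAtoms : Program → List ℕ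
headAtoms P = concatMap head P

Comp : Program → Form
Comp P = bigAnd (map (¬f_ ∘ var) (filterᵇ (λ a → not (memb a (headAtoms P))) (at P)))
      ∧f (bigAnd (map (λ r → bodyF r ⇒f bigOr (map var (head r))) P)
      ∧f bigAnd (map (λ a → var a ⇒f
                   bigOr (map (λ r → bodyF r ∧f
                                 bigAnd (map (¬f_ ∘ var) (filterᵇ (λ x → not (x ==ℕ a)) (head r))))
                              (filterᵇ (λ r → memb a (head r)) P)))
                 (headAtoms P)))

-- τ_M restricted to at(P) (atoms outside at(P) do not occur in Comp(P))
τ : List ℕ → ℕ → Bool
τ M x = memb x M

Edge : Program → ℕ → ℕ → Set
Edge P y x = Any (λ r → y ∈ head r × x ∈ pos r) P

data Path (P : Program) (L : List ℕ) : ℕ → ℕ → Set where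
  edge : ∀ {x y} → x ∈ L → y ∈ L → Edge P x y → Path P L x y
  step : ∀ {x z y} → x ∈ L → Edge P x z → Path P L z y → Path P L x y

IsLoop : Program → List ℕ → Set
IsLoop P L = L ⊆ at P × (∀ x y → x ∈ L → y ∈ L → Path P L x y)

LoopAtom : Program → ℕ → Set
LoopAtom P x = Σ (List ℕ) λ L → IsLoop P L × x ∈ L

Enumerates-LA : Program → List ℕ → Set
Enumerates-LA P la = ∀ x → (x ∈ la → LoopAtom P x) × (LoopAtom P x → x ∈ la)

data Var : Set where
  orig  : ℕ → Var
  prime : ℕ → Var      -- x' (fresh, distinct from every atom)

data Lit : Set where
  +_ : Var → Lit
  -_ : Var → Lit

Clause : Set
Clause = List Lit

CNF : Set
CNF = List Clause

Copy : Program → List ℕ → CNF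
Copy P la =
  map (λ x → - prime x ∷ + orig x ∷ []) la
  ++ map (λ r → map (-_ ∘ f) (pos r) ++ map (+_ ∘ orig) (neg r) ++ map (+_ ∘ f) (head r))
         (filterᵇ (λ r → any (λ a → memb a la) (head r)) P)
  where
  f : ℕ → Var
  f x = if memb x la then prime x else orig x

PAssign : Set
PAssign = Var → Maybe Bool

τM : Program → List ℕ → PAssign
τM P M (orig x)  = if memb x (at P) then just (memb x M) else nothing
τM P M (prime x) = nothing

litVal : PAssign → Lit → Maybe Bool
litVal σ (+ v) = σ v
litVal σ (- v) with σ v
... | just b  = just (not b)
... | nothing = nothing

isTrue isFalse : Maybe Bool → Bool
isTrue (just true) = true
isTrue _           = false
isFalse (just false) = true
isFalse _            = false

eqVar : Var → Var → Bool
eqVar (orig x)  (orig y)  = x ==ℕ y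
eqVar (prime x) (prime y) = x ==ℕ y
eqVar _ _ = false

eqLit : Lit → Lit → Bool
eqLit (+ u) (+ v) = eqVar u v
eqLit (- u) (- v) = eqVar u v
eqLit _ _ = false

compl : Lit → Lit
compl (+ v) = - v
compl (- v) = + v

isUnitOf : Lit → Clause → Bool
isUnitOf l (m ∷ []) = eqLit l m
isUnitOf l _        = false

upStep : PAssign → CNF → CNF
upStep σ φ =
  map (filterᵇ keep) (filterᵇ (λ C → not (any (isTrue ∘ litVal σ) C)) φ)
  where
  keep : Lit → Bool
  keep l = not (isFalse (litVal σ l)) ∧ not (any (isUnitOf (compl l)) φ)

iter : ℕ → (CNF → CNF) → CNF → CNF
iter zero    g φ = φ
iter (suc n) g φ = iter n g (g φ)

-- number of clauses plus number of literal occurrences: bounds the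
-- number of rounds that can change the formula, so after size φ + 1
-- rounds the fixpoint ("no syntactic change") is reached
size : CNF → ℕ
size φ = length φ + sum (map length φ)

UP : CNF → PAssign → CNF
UP φ σ = iter (suc (size φ)) (upStep σ) φ

Assign : Set
Assign = Var → Bool

litSat : Assign → Lit → Bool
litSat σ (+ v) = σ v
litSat σ (- v) = not (σ v)

SatCNF : Assign → CNF → Set
SatCNF σ φ = All (λ C → Any (λ l → litSat σ l ≡ true) C) φ

Unsatisfiable : CNF → Set
Unsatisfiable φ = ¬ (Σ Assign λ σ → SatCNF σ φ)

loopClause : List ℕ → List ℕ → Clause
loopClause M la = map (λ x → - prime x) (filterᵇ (λ x → memb x la) M)

-- Both directions compare models of the reduct P^M with assignments extending τ_M.  Say ρ
-- represents a pair N ⊆ M when ρ(x) says x ∈ M and ρ(f x) says x ∈ N, f being the renaming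
-- x ↦ x' of loop atoms used in Copy(P).  Then ρ satisfies Copy(P) as soon as N ⊨ P^M, and
-- conversely when M ⊨ P and M ∖ N consists of loop atoms (a rule without loop atoms in its head
-- is satisfied by N because it is by M).  Unit propagation under τ_M preserves and reflects
-- satisfaction by every extension of τ_M, and leaves no variable assigned by τ_M in the formula,
-- so a model of its result can be reset to τ_M there.
--
-- If M is an answer set and ρ satisfies the formula, the atoms x ∈ M with ρ(f x) true form a
-- model N ⊆ M of P^M, and the loop clause makes N miss an atom of M.  Conversely, if N ⊊ M
-- models P^M, the completion supports every atom of the unfounded set U = M ∖ N by a rule with a
-- positive body atom in U, so every atom of U has a successor in U in the positive dependency
-- graph; a terminal strongly connected part L of U is then a loop, M ∖ L still models P^M, and
-- the assignment representing (M, M ∖ L) satisfies the formula.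
module Submission where

open import Defs

open import Data.Bool as Bool using (Bool; true; false; not; _∧_; if_then_else_; T)
open import Data.Bool.ListAction using (any)
open import Data.Bool.Properties using (T-≡; T-not-≡; ∧-conicalˡ; ∧-conicalʳ; not-involutive)
open import Data.Empty using (⊥; ⊥-elim)
open import Data.List using (List; []; _∷_; [_]; _++_; map; filterᵇ; length)
open import Data.List.Membership.Propositional using (_∈_; _∉_; find; lose)
open import Data.List.Membership.Propositional.Properties
  using (∈-map⁺; ∈-map⁻; ∈-++⁺ˡ; ∈-++⁺ʳ; ∈-filter⁺; ∈-filter⁻; ∈-concat⁺′)
open import Data.List.Properties using (filter-notAll)
open import Data.List.Relation.Unary.All as All using (All; []; _∷_)
import Data.List.Relation.Unary.All.Properties as All
open import Data.List.Relation.Unary.Any as Any using (Any; here; there; any?)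
import Data.List.Relation.Unary.Any.Properties as Any
open import Data.Maybe using (just; nothing; fromMaybe)
open import Data.Nat using (ℕ; zero; suc; _<_) renaming (_≡ᵇ_ to _==ℕ_)
open import Data.Nat.Induction using (<-wellFounded)
open import Data.Nat.Properties using (_≟_; ≡ᵇ⇒≡; ≡⇒≡ᵇ)
open import Data.List.Membership.DecPropositional _≟_ using (_∈?_)
open import Data.Product using (Σ; ∃-syntax; _×_; _,_; proj₁; proj₂)
open import Data.Sum using (_⊎_; inj₁; inj₂)
open import Function using (_∘_; id; case_of_; _on_)
open import Function.Bundles using (_⇔_; mk⇔; Equivalence)
open import Induction.WellFounded using (Acc; acc)
import Relation.Binary.Construct.On as On
open import Relation.Binary.PropositionalEquality
  using (_≡_; _≢_; refl; sym; trans; cong; cong₂; subst)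
open import Relation.Nullary
  using (¬_; Dec; does; yes; no; contradiction; ¬?; ¬¬-excluded-middle)
open import Relation.Nullary.Decidable using (dec-true; dec-false; decidable-stable; T?)

open Equivalence using (to; from)

private variable
  x a : ℕ
  xs ys M N : List ℕ
  P : Program
  r : Rule

memb≡true⇔ : memb x xs ≡ true ⇔ x ∈ xs
memb≡true⇔ {x} {xs} with x ∈? xs
... | yes x∈xs = mk⇔ (λ _ → x∈xs) (λ _ → refl)
... | no x∉xs  = mk⇔ (λ ()) (λ x∈xs → contradiction x∈xs x∉xs)

not-memb≡true⇔ : not (memb x xs) ≡ true ⇔ x ∉ xs
not-memb≡true⇔ {x} {xs} with x ∈? xs
... | yes x∈xs = mk⇔ (λ ()) (λ x∉xs → contradiction x∈xs x∉xs)
... | no x∉xs  = mk⇔ (λ _ → x∉xs) (λ _ → refl)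

≢⇒not-≡ᵇ : ∀ {m n} → m ≢ n → not (m ==ℕ n) ≡ true
≢⇒not-≡ᵇ {m} {n} m≢n with m ==ℕ n in eq
... | true  = contradiction (≡ᵇ⇒≡ m n (from T-≡ eq)) m≢n
... | false = refl

module _ {A : Set} (p : A → Bool) where

  any≡true⇔ : ∀ {zs} → any p zs ≡ true ⇔ Any (λ z → p z ≡ true) zs
  any≡true⇔ = mk⇔ (Any.map (to T-≡) ∘ Any.any⁻ p _ ∘ from T-≡)
                  (to T-≡ ∘ Any.any⁺ p ∘ Any.map (from T-≡))

  not-any≡true⇔ : ∀ {zs} → not (any p zs) ≡ true ⇔ All (λ z → not (p z) ≡ true) zs
  not-any≡true⇔ {[]}     = mk⇔ (λ _ → []) (λ _ → refl)
  not-any≡true⇔ {z ∷ zs} with p z in pz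
  ... | true  = mk⇔ (λ ()) (λ { (¬pz ∷ _) → contradiction (trans (sym (cong not pz)) ¬pz) λ () })
  ... | false = mk⇔ (λ e → cong not pz ∷ to not-any≡true⇔ e)
                    (λ { (_ ∷ h) → from not-any≡true⇔ h })

  module _ {y : A} {zs : List A} where

    ∈-filterᵇ⁺ : y ∈ zs → p y ≡ true → y ∈ filterᵇ p zs
    ∈-filterᵇ⁺ y∈zs py = ∈-filter⁺ (T? ∘ p) y∈zs (from T-≡ py)

    ∈-filterᵇ⁻ : y ∈ filterᵇ p zs → y ∈ zs × p y ≡ true
    ∈-filterᵇ⁻ y∈ = let y∈zs , py = ∈-filter⁻ (T? ∘ p) {xs = zs} y∈ in y∈zs , to T-≡ py

not-any-memb⇔ : not (any (λ x → memb x ys) xs) ≡ true ⇔ All (_∉ ys) xs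
not-any-memb⇔ = mk⇔ (All.map (to not-memb≡true⇔) ∘ to (not-any≡true⇔ _))
                    (from (not-any≡true⇔ _) ∘ All.map (from not-memb≡true⇔))

memb-filterᵇ : ∀ p → x ∈ xs → memb x (filterᵇ p xs) ≡ p x
memb-filterᵇ {x} {xs} p x∈xs with p x in px
... | true  = from memb≡true⇔ (∈-filterᵇ⁺ p x∈xs px)
... | false = dec-false (x ∈? filterᵇ p xs) λ x∈ →
  contradiction (trans (sym px) (proj₂ (∈-filterᵇ⁻ p {zs = xs} x∈))) λ ()

memb-filterᵇ-∉ : ∀ p → x ∉ xs → memb x (filterᵇ p xs) ≡ false
memb-filterᵇ-∉ {x} {xs} p x∉xs =
  dec-false (x ∈? filterᵇ p xs) (x∉xs ∘ proj₁ ∘ ∈-filterᵇ⁻ p {zs = xs})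

infixl 25 _∖_

-- Opaque, so that xs ∖ ys stays visible to unification instead of unfolding to a filter.
opaque
  _∖_ : List ℕ → List ℕ → List ℕ
  xs ∖ ys = filterᵇ (λ x → not (memb x ys)) xs

  ∈-∖⁺ : x ∈ xs → x ∉ ys → x ∈ xs ∖ ys
  ∈-∖⁺ x∈xs x∉ys = ∈-filterᵇ⁺ _ x∈xs (from not-memb≡true⇔ x∉ys)

  ∈-∖⁻ : x ∈ xs ∖ ys → x ∈ xs × x ∉ ys
  ∈-∖⁻ {xs = xs} {ys} x∈ =
    let x∈xs , x∉ys = ∈-filterᵇ⁻ (λ x → not (memb x ys)) {zs = xs} x∈
    in x∈xs , to not-memb≡true⇔ x∉ys

∖-⊆ : xs ∖ ys ⊆ xs
∖-⊆ = All.tabulate (proj₁ ∘ ∈-∖⁻)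

Holds : (ℕ → Bool) → Form → Set
Holds σ φ = eval σ φ ≡ true

module _ {σ : ℕ → Bool} where

  eval-bigAnd⇔ : ∀ φs → Holds σ (bigAnd φs) ⇔ All (Holds σ) φs
  eval-bigAnd⇔ []       = mk⇔ (λ _ → []) (λ _ → refl)
  eval-bigAnd⇔ (φ ∷ φs) = mk⇔
    (λ e → ∧-conicalˡ _ _ e ∷ to (eval-bigAnd⇔ φs) (∧-conicalʳ _ _ e))
    (λ { (e ∷ es) → subst (λ b → b ∧ _ ≡ true) (sym e) (from (eval-bigAnd⇔ φs) es) })

  eval-bigOr⁻ : ∀ φs → Holds σ (bigOr φs) → Any (Holds σ) φs
  eval-bigOr⁻ (φ ∷ φs) e with eval σ φ in eφ
  ... | true  = here eφ
  ... | false = there (eval-bigOr⁻ φs e)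

  eval-⇒f : ∀ φ ψ → Holds σ (φ ⇒f ψ) → Holds σ φ → Holds σ ψ
  eval-⇒f φ ψ e eφ rewrite eφ = e

eval-bodyF⇔ : Holds (τ M) (bodyF r) ⇔ (All (_∈ M) (pos r) × All (_∉ M) (neg r))
eval-bodyF⇔ {M} {r} = mk⇔
  (λ e → let ps , ns = All.++⁻ (map var (pos r)) (to (eval-bigAnd⇔ _) e)
         in All.map (to memb≡true⇔) (All.map⁻ ps) , All.map (to not-memb≡true⇔) (All.map⁻ ns))
  (λ (ps , ns) → from (eval-bigAnd⇔ _)
     (All.++⁺ (All.map⁺ (All.map (from memb≡true⇔) ps))
              (All.map⁺ (All.map (from not-memb≡true⇔) ns))))

∈-at : r ∈ P → x ∈ head r ++ pos r ++ neg r → x ∈ at P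
∈-at r∈P x∈r = ∈-concat⁺′ x∈r (∈-map⁺ _ r∈P)

⊨r-intro : (All (_∈ M) (pos r) → All (_∉ M) (neg r) → Any (_∈ M) (head r)) → M ⊨r r
⊨r-intro {M} {r} fires with All.all? (_∈? M) (pos r) | All.all? (λ c → ¬? (c ∈? M)) (neg r)
... | yes ps | yes ns = inj₁ (Any.++⁺ˡ (fires ps ns))
... | no ¬ps | _      = inj₂ (All.¬All⇒Any¬ (_∈? M) (pos r) ¬ps)
... | _      | no ¬ns = inj₁ (Any.++⁺ʳ (head r) (Any.map (decidable-stable (_ ∈? M))
                                (All.¬All⇒Any¬ (λ c → ¬? (c ∈? M)) (neg r) ¬ns)))

⊨r-fire : M ⊨r r → All (_∈ M) (pos r) → All (_∉ M) (neg r) → Any (_∈ M) (head r)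
⊨r-fire {r = r} (inj₁ h∪n) ps ns with Any.++⁻ (head r) h∪n
... | inj₁ h = h
... | inj₂ n = let c , c∈neg , c∈M = find n in contradiction c∈M (All.lookup ns c∈neg)
⊨r-fire (inj₂ p) ps ns = let b , b∈pos , b∉M = find p in contradiction (All.lookup ps b∈pos) b∉M

_⊨⁺_ : List ℕ → Rule → Set
N ⊨⁺ r = Any (_∈ N) (head r) ⊎ Any (_∉ N) (pos r)

positive : Rule → Rule
positive r = mkRule (head r) (pos r) []

∈-reduct⁺ : r ∈ P → All (_∉ M) (neg r) → positive r ∈ reduct P M
∈-reduct⁺ r∈P ns = ∈-map⁺ positive (∈-filterᵇ⁺ _ r∈P (from not-any-memb⇔ ns))

∈-reduct⁻ : ∀ {r′} → r′ ∈ reduct P M → ∃[ r ] r ∈ P × All (_∉ M) (neg r) × r′ ≡ positive r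
∈-reduct⁻ {P} {M} r′∈ =
  let r , r∈ , r′≡ = ∈-map⁻ positive r′∈
      r∈P , ns = ∈-filterᵇ⁻ (λ r → not (any (λ c → memb c M) (neg r))) {zs = P} r∈
  in r , r∈P , to not-any-memb⇔ ns , r′≡

⊨r-positive⇔ : N ⊨r positive r ⇔ N ⊨⁺ r
⊨r-positive⇔ {N} {r} = mk⇔
  (λ { (inj₁ h) → inj₁ (head-only (Any.++⁻ (head r) h)) ; (inj₂ p) → inj₂ p })
  (λ { (inj₁ h) → inj₁ (Any.++⁺ˡ h) ; (inj₂ p) → inj₂ p })
  where
  head-only : Any (_∈ N) (head r) ⊎ Any (_∈ N) [] → Any (_∈ N) (head r)
  head-only (inj₁ h) = h

reduct-model⇔ : N ⊨ reduct P M ⇔ (∀ {r} → r ∈ P → All (_∉ M) (neg r) → N ⊨⁺ r)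
reduct-model⇔ {N} {P} {M} = mk⇔ model⇒ model⇐
  where
  model⇒ : N ⊨ reduct P M → ∀ {r} → r ∈ P → All (_∉ M) (neg r) → N ⊨⁺ r
  model⇒ N⊨ {r} r∈P ns = to (⊨r-positive⇔ {N} {r}) (All.lookup N⊨ (∈-reduct⁺ {r} {P} {M} r∈P ns))

  model⇐ : (∀ {r} → r ∈ P → All (_∉ M) (neg r) → N ⊨⁺ r) → N ⊨ reduct P M
  model⇐ h = All.tabulate λ r′∈ →
    let r , r∈P , ns , r′≡ = ∈-reduct⁻ {P} {M} r′∈
    in subst (N ⊨r_) (sym r′≡) (from (⊨r-positive⇔ {N} {r}) (h r∈P ns))

-- The Clark completion

nonHeadAtoms : Program → List ℕ
nonHeadAtoms P = filterᵇ (λ a → not (memb a (headAtoms P))) (at P)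

ruleClauses : Program → List Form
ruleClauses P = map (λ r → bodyF r ⇒f bigOr (map var (head r))) P

supportDisjunct : ℕ → Rule → Form
supportDisjunct a r = bodyF r ∧f bigAnd (map (¬f_ ∘ var) (filterᵇ (λ x → not (x ==ℕ a)) (head r)))

supportClauses : Program → List Form
supportClauses P =
  map (λ a → var a ⇒f bigOr (map (supportDisjunct a) (filterᵇ (λ r → memb a (head r)) P))) (headAtoms P)

record CompletionHolds (σ : ℕ → Bool) (P : Program) : Set where
  field
    nonHeadAtoms-false : All (Holds σ) (map (¬f_ ∘ var) (nonHeadAtoms P))
    ruleClauses-hold   : All (Holds σ) (ruleClauses P)
    supportClauses-hold : All (Holds σ) (supportClauses P)

Comp⁻ : ∀ {σ} → Holds σ (Comp P) → CompletionHolds σ P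
Comp⁻ {P} {σ} comp = record
  { nonHeadAtoms-false  = to (eval-bigAnd⇔ _) (∧-conicalˡ negations rest comp)
  ; ruleClauses-hold    = to (eval-bigAnd⇔ _) (∧-conicalˡ rules supports (∧-conicalʳ negations rest comp))
  ; supportClauses-hold = to (eval-bigAnd⇔ _) (∧-conicalʳ rules supports (∧-conicalʳ negations rest comp))
  }
  where
  negations = eval σ (bigAnd (map (¬f_ ∘ var) (nonHeadAtoms P)))
  rules     = eval σ (bigAnd (ruleClauses P))
  supports  = eval σ (bigAnd (supportClauses P))
  rest      = rules ∧ supports

comp⇒model : Holds (τ M) (Comp P) → M ⊨ P
comp⇒model {M} {P} comp = All.tabulate λ {r} r∈P → ⊨r-intro {M} {r} (fires r∈P)
  where
  fires : ∀ {r} → r ∈ P → All (_∈ M) (pos r) → All (_∉ M) (neg r) → Any (_∈ M) (head r)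
  fires {r} r∈P ps ns =
    let rule-clause = All.lookup (CompletionHolds.ruleClauses-hold (Comp⁻ {P} {τ M} comp)) (∈-map⁺ _ r∈P)
        head-holds = eval-⇒f (bodyF r) (bigOr (map var (head r))) rule-clause
                       (from (eval-bodyF⇔ {M} {r}) (ps , ns))
    in Any.map (to memb≡true⇔) (Any.map⁻ (eval-bigOr⁻ (map var (head r)) head-holds))

record Support (P : Program) (M : List ℕ) (a : ℕ) : Set where
  field
    rule     : Rule
    rule∈P   : rule ∈ P
    a∈head   : a ∈ head rule
    pos⊆M    : All (_∈ M) (pos rule)
    neg∩M≡∅  : All (_∉ M) (neg rule)
    head∩M≡a : ∀ {h} → h ∈ head rule → h ∈ M → h ≡ a

supportDisjunct⇒Support : r ∈ P → a ∈ head r → Holds (τ M) (supportDisjunct a r) → Support P M a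
supportDisjunct⇒Support {r} {P} {a} {M} r∈P a∈head holds = record
  { rule = r ; rule∈P = r∈P ; a∈head = a∈head
  ; pos⊆M = proj₁ body ; neg∩M≡∅ = proj₂ body ; head∩M≡a = only-a }
  where
  others = bigAnd (map (¬f_ ∘ var) (filterᵇ (λ x → not (x ==ℕ a)) (head r)))
  body = to (eval-bodyF⇔ {M} {r}) (∧-conicalˡ (eval (τ M) (bodyF r)) (eval (τ M) others) holds)

  only-a : ∀ {h} → h ∈ head r → h ∈ M → h ≡ a
  only-a {h} h∈head h∈M with h ≟ a
  ... | yes h≡a = h≡a
  ... | no h≢a  = contradiction h∈M (to not-memb≡true⇔ (All.lookup
      (to (eval-bigAnd⇔ _) (∧-conicalʳ (eval (τ M) (bodyF r)) (eval (τ M) others) holds))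
      (∈-map⁺ _ (∈-filterᵇ⁺ _ h∈head (≢⇒not-≡ᵇ h≢a)))))

comp⇒support : M ⊆ at P → Holds (τ M) (Comp P) → a ∈ M → Support P M a
comp⇒support {M} {P} {a} M⊆atP comp a∈M with a ∈? headAtoms P
... | no a∉heads = contradiction a∈M (to not-memb≡true⇔ (All.lookup nonHeadAtoms-false
      (∈-map⁺ _ (∈-filterᵇ⁺ _ (All.lookup M⊆atP a∈M) (from not-memb≡true⇔ a∉heads)))))
  where open CompletionHolds (Comp⁻ {P} {τ M} comp)
... | yes a∈heads =
  let supported = eval-⇒f (var a) (bigOr (map (supportDisjunct a) candidates))
                    (All.lookup supportClauses-hold (∈-map⁺ _ a∈heads)) (from memb≡true⇔ a∈M)
      r , r∈ , holds = find (Any.map⁻ (eval-bigOr⁻ _ supported))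
      r∈P , a∈head = ∈-filterᵇ⁻ (λ r → memb a (head r)) {zs = P} r∈
  in supportDisjunct⇒Support r∈P (to memb≡true⇔ a∈head) holds
  where
  open CompletionHolds (Comp⁻ {P} {τ M} comp)
  candidates = filterᵇ (λ r → memb a (head r)) P

-- Unit propagation

Extends : PAssign → Assign → Set
Extends σ ρ = ∀ v {b} → σ v ≡ just b → ρ v ≡ b

ClauseSat : Assign → Clause → Set
ClauseSat ρ = Any (λ l → litSat ρ l ≡ true)

eqLit-sound : ∀ l m → eqLit l m ≡ true → l ≡ m
eqLit-sound (+ orig x)  (+ orig y)  e = cong (+_ ∘ orig) (≡ᵇ⇒≡ x y (from T-≡ e))
eqLit-sound (+ prime x) (+ prime y) e = cong (+_ ∘ prime) (≡ᵇ⇒≡ x y (from T-≡ e))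
eqLit-sound (- orig x)  (- orig y)  e = cong (-_ ∘ orig) (≡ᵇ⇒≡ x y (from T-≡ e))
eqLit-sound (- prime x) (- prime y) e = cong (-_ ∘ prime) (≡ᵇ⇒≡ x y (from T-≡ e))

isUnitOf-sound : ∀ l C → isUnitOf l C ≡ true → C ≡ [ l ]
isUnitOf-sound l (m ∷ []) e = cong [_] (sym (eqLit-sound l m e))

litSat-compl : ∀ ρ l → litSat ρ (compl l) ≡ not (litSat ρ l)
litSat-compl ρ (+ v) = refl
litSat-compl ρ (- v) = sym (not-involutive (ρ v))

satisfied-clause : PAssign → Clause → Bool
satisfied-clause σ C = any (isTrue ∘ litVal σ) C

kept-literal : PAssign → CNF → Lit → Bool
kept-literal σ φ l = not (isFalse (litVal σ l)) ∧ not (any (isUnitOf (compl l)) φ)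

∈-upStep⁻ : ∀ {σ φ C′} → C′ ∈ upStep σ φ →
            ∃[ C ] C ∈ φ × not (satisfied-clause σ C) ≡ true × C′ ≡ filterᵇ (kept-literal σ φ) C
∈-upStep⁻ {σ} {φ} C′∈ =
  let C , C∈ , C′≡ = ∈-map⁻ (filterᵇ (kept-literal σ φ)) C′∈
      C∈φ , unsat = ∈-filterᵇ⁻ (λ C → not (satisfied-clause σ C)) {zs = φ} C∈
  in C , C∈φ , unsat , C′≡

∈-upStep⁺ : ∀ {σ φ C} → C ∈ φ → not (satisfied-clause σ C) ≡ true →
            filterᵇ (kept-literal σ φ) C ∈ upStep σ φ
∈-upStep⁺ {σ} {φ} C∈φ unsat =
  ∈-map⁺ (filterᵇ (kept-literal σ φ)) (∈-filterᵇ⁺ (λ C → not (satisfied-clause σ C)) C∈φ unsat)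

module _ {σ : PAssign} {ρ : Assign} (ρ⊇σ : Extends σ ρ) where

  litVal-extends : ∀ l {b} → litVal σ l ≡ just b → litSat ρ l ≡ b
  litVal-extends (+ v) σv = ρ⊇σ v σv
  litVal-extends (- v) σ¬v with σ v in σv
  litVal-extends (- v) refl | just b = cong not (ρ⊇σ v σv)

  true-literal-not-false : ∀ {l} → litSat ρ l ≡ true → isFalse (litVal σ l) ≡ false
  true-literal-not-false {l} l-true with litVal σ l in σl
  ... | just true  = refl
  ... | nothing    = refl
  ... | just false = contradiction (trans (sym l-true) (litVal-extends l σl)) λ ()

  no-unit-complement : ∀ {l ψ} → SatCNF ρ ψ → litSat ρ l ≡ true → any (isUnitOf (compl l)) ψ ≡ false
  no-unit-complement [] l-true = refl
  no-unit-complement {l} {C ∷ ψ} (C-sat ∷ ψ-sat) l-true with isUnitOf (compl l) C in unit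
  ... | false = no-unit-complement ψ-sat l-true
  ... | true with isUnitOf-sound (compl l) C unit
  ...   | refl with C-sat
  ...     | here compl-true =
    contradiction (trans (sym compl-true) (trans (litSat-compl ρ l) (cong not l-true))) λ ()

  true-literal-kept : ∀ {φ l} → SatCNF ρ φ → litSat ρ l ≡ true → kept-literal σ φ l ≡ true
  true-literal-kept {l = l} sat l-true =
    cong₂ (λ b c → not b ∧ not c) (true-literal-not-false {l} l-true) (no-unit-complement sat l-true)

  upStep-complete : ∀ {φ} → SatCNF ρ φ → SatCNF ρ (upStep σ φ)
  upStep-complete sat = All.tabulate λ C′∈ →
    let C , C∈φ , _ , C′≡ = ∈-upStep⁻ C′∈
        l , l∈C , l-true = find (All.lookup sat C∈φ)
    in subst (ClauseSat ρ) (sym C′≡) (lose (∈-filterᵇ⁺ _ l∈C (true-literal-kept sat l-true)) l-true)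

  upStep-sound : ∀ {φ} → SatCNF ρ (upStep σ φ) → SatCNF ρ φ
  upStep-sound {φ} sat = All.tabulate λ {C} → sound C
    where
    isTrue-just : ∀ {m} → isTrue m ≡ true → m ≡ just true
    isTrue-just {just true} _ = refl

    sound : ∀ C → C ∈ φ → ClauseSat ρ C
    sound C C∈φ with satisfied-clause σ C in C-sat
    ... | true  = let l , l∈C , l-true = find (to (any≡true⇔ _) C-sat) in
      lose l∈C (litVal-extends l (isTrue-just l-true))
    ... | false = let l , l∈ , l-true = find (All.lookup sat (∈-upStep⁺ C∈φ (cong not C-sat))) in
      lose (proj₁ (∈-filterᵇ⁻ (kept-literal σ φ) l∈)) l-true

Unassigned : PAssign → CNF → Set
Unassigned σ = All (All (λ l → litVal σ l ≡ nothing))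

upStep-unassigned : ∀ σ φ → Unassigned σ (upStep σ φ)
upStep-unassigned σ φ = All.tabulate λ C′∈ →
  let C , _ , unsat , C′≡ = ∈-upStep⁻ {σ} {φ} C′∈
  in subst (All _) (sym C′≡) (All.tabulate λ l∈ →
       let l∈C , kept = ∈-filterᵇ⁻ (kept-literal σ φ) {zs = C} l∈
       in neither-true-nor-false (All.lookup (to (not-any≡true⇔ (isTrue ∘ litVal σ)) unsat) l∈C)
                                 (∧-conicalˡ _ _ kept))
  where
  neither-true-nor-false : ∀ {m} → not (isTrue m) ≡ true → not (isFalse m) ≡ true → m ≡ nothing
  neither-true-nor-false {nothing}    _  _  = refl
  neither-true-nor-false {just true}  () _
  neither-true-nor-false {just false} _  ()

upStep-preserves-unassigned : ∀ σ {φ} → Unassigned σ φ → Unassigned σ (upStep σ φ)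
upStep-preserves-unassigned σ {φ} unassigned = All.tabulate λ C′∈ →
  let C , C∈φ , _ , C′≡ = ∈-upStep⁻ {σ} {φ} C′∈
  in subst (All _) (sym C′≡) (All.tabulate λ l∈ →
       All.lookup (All.lookup unassigned C∈φ) (proj₁ (∈-filterᵇ⁻ (kept-literal σ φ) {zs = C} l∈)))

module _ (Q : CNF → Set) (g : CNF → CNF) where

  iter-preserves : (∀ {ψ} → Q ψ → Q (g ψ)) → ∀ n {φ} → Q φ → Q (iter n g φ)
  iter-preserves pres zero    q = q
  iter-preserves pres (suc n) q = iter-preserves pres n (pres q)

  iter-reflects : (∀ {ψ} → Q (g ψ) → Q ψ) → ∀ n {φ} → Q (iter n g φ) → Q φ
  iter-reflects back zero    q = q
  iter-reflects back (suc n) q = back (iter-reflects back n q)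

UP-unassigned : ∀ σ φ → Unassigned σ (UP φ σ)
UP-unassigned σ φ =
  iter-preserves (Unassigned σ) (upStep σ) (upStep-preserves-unassigned σ) (size φ) (upStep-unassigned σ φ)

module _ {σ : PAssign} {ρ : Assign} (ρ⊇σ : Extends σ ρ) where

  UP-complete : ∀ {φ} → SatCNF ρ φ → SatCNF ρ (UP φ σ)
  UP-complete {φ} = iter-preserves (SatCNF ρ) (upStep σ) (upStep-complete ρ⊇σ) (suc (size φ))

  UP-sound : ∀ {φ} → SatCNF ρ (UP φ σ) → SatCNF ρ φ
  UP-sound {φ} = iter-reflects (SatCNF ρ) (upStep σ) (upStep-sound ρ⊇σ) (suc (size φ))

_◃_ : PAssign → Assign → Assign
(σ ◃ ρ) v = fromMaybe (ρ v) (σ v)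

◃-extends : ∀ σ ρ → Extends σ (σ ◃ ρ)
◃-extends σ ρ v σv rewrite σv = refl

◃-unassigned : ∀ σ ρ l → litVal σ l ≡ nothing → litSat (σ ◃ ρ) l ≡ litSat ρ l
◃-unassigned σ ρ (+ v) σv rewrite σv = refl
◃-unassigned σ ρ (- v) σv with σ v
... | nothing = refl

UP-sat⇒◃-sat : ∀ σ ρ φ → SatCNF ρ (UP φ σ) → SatCNF (σ ◃ ρ) φ
UP-sat⇒◃-sat σ ρ φ sat = UP-sound (◃-extends σ ρ) (All.tabulate λ C∈ →
  let l , l∈C , l-true = find (All.lookup sat C∈)
      unassigned = All.lookup (All.lookup (UP-unassigned σ φ) C∈) l∈C
  in lose l∈C (trans (◃-unassigned σ ρ l unassigned) l-true))

-- The copy program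

-- The renaming f of Copy(P).
copyVar : List ℕ → ℕ → Var
copyVar la x = if memb x la then prime x else orig x

loopAxiom : ℕ → Clause
loopAxiom x = - prime x ∷ + orig x ∷ []

copyClause : List ℕ → Rule → Clause
copyClause la r = map (-_ ∘ copyVar la) (pos r) ++ map (+_ ∘ orig) (neg r) ++ map (+_ ∘ copyVar la) (head r)

module _ {la : List ℕ} where

  copyVar-loop : x ∈ la → copyVar la x ≡ prime x
  copyVar-loop {x} x∈la rewrite dec-true (x ∈? la) x∈la = refl

  Copy-sat⇔ : ∀ {ρ P} → SatCNF ρ (Copy P la) ⇔
              (All (ClauseSat ρ ∘ loopAxiom) la ×
               (∀ {r} → r ∈ P → Any (_∈ la) (head r) → ClauseSat ρ (copyClause la r)))
  Copy-sat⇔ {ρ} {P} = mk⇔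
    (λ sat → let axioms , rules = All.++⁻ (map loopAxiom la) sat in
      All.map⁻ axioms , λ {r} r∈P hits → All.lookup rules (∈-map⁺ (copyClause la)
        (∈-filterᵇ⁺ loopRule? r∈P (from (any≡true⇔ _) (Any.map (from memb≡true⇔) hits)))))
    (λ (axioms , rules) → All.++⁺ (All.map⁺ axioms) (All.tabulate λ C∈ →
      let r , r∈ , C≡ = ∈-map⁻ (copyClause la) C∈
          r∈P , hits = ∈-filterᵇ⁻ loopRule? {zs = P} r∈
      in subst (ClauseSat ρ) (sym C≡) (rules r∈P (Any.map (to memb≡true⇔) (to (any≡true⇔ _) hits)))))
    where
    loopRule? : Rule → Bool
    loopRule? r = any (λ a → memb a la) (head r)

  record Represents (ρ : Assign) (M N : List ℕ) (x : ℕ) : Set where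
    constructor represents
    field
      orig-value : ρ (orig x) ≡ memb x M
      copy-value : ρ (copyVar la x) ≡ memb x N
  open Represents public

  represents-loop : ∀ {ρ M N} → Represents ρ M N x → x ∈ la → ρ (prime x) ≡ memb x N
  represents-loop {ρ = ρ} rep x∈la = trans (cong ρ (sym (copyVar-loop x∈la))) (copy-value rep)

  represents-unsupported : ∀ {ρ M N} → Represents ρ M N x → x ∈ M → x ∉ N → x ∈ la
  represents-unsupported {x} (represents orig-x copy-x) x∈M x∉N with x ∈? la
  ... | yes x∈la = x∈la
  ... | no _     = contradiction (trans (sym (from memb≡true⇔ x∈M)) (trans (sym orig-x) copy-x))
                                 (x∉N ∘ to memb≡true⇔ ∘ sym)

  copyClause-sat⇔ : ∀ {ρ M N r} → (∀ {x} → x ∈ head r ++ pos r ++ neg r → Represents ρ M N x) →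
                    ClauseSat ρ (copyClause la r) ⇔ (All (_∉ M) (neg r) → N ⊨⁺ r)
  copyClause-sat⇔ {ρ} {M} {N} {r} rep = mk⇔ clause⇒ clause⇐
    where
    rep-head : ∀ {h} → h ∈ head r → Represents ρ M N h
    rep-head = rep ∘ ∈-++⁺ˡ
    rep-pos : ∀ {b} → b ∈ pos r → Represents ρ M N b
    rep-pos = rep ∘ ∈-++⁺ʳ (head r) ∘ ∈-++⁺ˡ
    rep-neg : ∀ {c} → c ∈ neg r → Represents ρ M N c
    rep-neg = rep ∘ ∈-++⁺ʳ (head r) ∘ ∈-++⁺ʳ (pos r)

    clause⇒ : ClauseSat ρ (copyClause la r) → All (_∉ M) (neg r) → N ⊨⁺ r
    clause⇒ sat ns with Any.++⁻ (map (-_ ∘ copyVar la) (pos r)) sat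
    ... | inj₁ p = let b , b∈ , b-false = find (Any.map⁻ p) in
      inj₂ (lose b∈ (to not-memb≡true⇔
        (subst (λ v → not v ≡ true) (copy-value (rep-pos b∈)) b-false)))
    ... | inj₂ n∪h with Any.++⁻ (map (+_ ∘ orig) (neg r)) n∪h
    ...   | inj₁ n = let c , c∈ , c-true = find (Any.map⁻ n) in
      contradiction (to memb≡true⇔ (trans (sym (orig-value (rep-neg c∈))) c-true)) (All.lookup ns c∈)
    ...   | inj₂ h = let a , a∈ , a-true = find (Any.map⁻ h) in
      inj₁ (lose a∈ (to memb≡true⇔ (trans (sym (copy-value (rep-head a∈))) a-true)))

    clause⇐ : (All (_∉ M) (neg r) → N ⊨⁺ r) → ClauseSat ρ (copyClause la r)
    clause⇐ fires with any? (_∈? M) (neg r)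
    ... | yes n = let c , c∈ , c∈M = find n in
      Any.++⁺ʳ (map (-_ ∘ copyVar la) (pos r)) (Any.++⁺ˡ (Any.map⁺
        (lose c∈ (trans (orig-value (rep-neg c∈)) (from memb≡true⇔ c∈M)))))
    ... | no ¬n with fires (All.¬Any⇒All¬ (neg r) ¬n)
    ...   | inj₁ h = let a , a∈ , a∈N = find h in
      Any.++⁺ʳ (map (-_ ∘ copyVar la) (pos r)) (Any.++⁺ʳ (map (+_ ∘ orig) (neg r)) (Any.map⁺
        (lose a∈ (trans (copy-value (rep-head a∈)) (from memb≡true⇔ a∈N)))))
    ...   | inj₂ p = let b , b∈ , b∉N = find p in
      Any.++⁺ˡ (Any.map⁺ (lose b∈
        (subst (λ v → not v ≡ true) (sym (copy-value (rep-pos b∈))) (from not-memb≡true⇔ b∉N))))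

  copy-sat⇒reduct-model : ∀ {ρ P M N} → M ⊨ P → N ⊆ M →
                          (∀ {x} → x ∈ M → x ∉ N → x ∈ la) →
                          (∀ {x} → x ∈ at P → Represents ρ M N x) →
                          SatCNF ρ (Copy P la) → N ⊨ reduct P M
  copy-sat⇒reduct-model {ρ} {P} {M} {N} M⊨P N⊆M unsupported⊆la rep sat =
    from (reduct-model⇔ {N} {P} {M}) N⊨⁺
    where
    N⊨⁺ : ∀ {r} → r ∈ P → All (_∉ M) (neg r) → N ⊨⁺ r
    N⊨⁺ {r} r∈P ns with any? (_∈? la) (head r)
    ... | yes hits =
      to (copyClause-sat⇔ (rep ∘ ∈-at r∈P)) (proj₂ (to (Copy-sat⇔ {ρ} {P}) sat) r∈P hits) ns
    ... | no ¬hits with All.lookup M⊨P r∈P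
    ...   | inj₂ p = inj₂ (Any.map (λ b∉M b∈N → b∉M (All.lookup N⊆M b∈N)) p)
    ...   | inj₁ h∪n with Any.++⁻ (head r) h∪n
    ...     | inj₂ n = let c , c∈ , c∈M = find n in contradiction c∈M (All.lookup ns c∈)
    ...     | inj₁ h = let a , a∈ , a∈M = find h in
      inj₁ (lose a∈ (in-N a∈M (λ a∈la → ¬hits (lose a∈ a∈la))))
      where
      in-N : ∀ {a} → a ∈ M → a ∉ la → a ∈ N
      in-N {a} a∈M a∉la with a ∈? N
      ... | yes a∈N = a∈N
      ... | no a∉N  = contradiction (unsupported⊆la a∈M a∉N) a∉la

  reduct-model⇒copy-sat : ∀ {ρ P M N} → N ⊆ M → (∀ x → Represents ρ M N x) →
                          N ⊨ reduct P M → SatCNF ρ (Copy P la)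
  reduct-model⇒copy-sat {ρ} {P} {M} {N} N⊆M rep N⊨ = from (Copy-sat⇔ {ρ} {P})
    ( All.tabulate axiom
    , λ r∈P _ → from (copyClause-sat⇔ (λ {x} _ → rep x)) (to (reduct-model⇔ {N} {P} {M}) N⊨ r∈P) )
    where
    axiom : ∀ {x} → x ∈ la → ClauseSat ρ (loopAxiom x)
    axiom {x} x∈la with x ∈? N
    ... | yes x∈N = there (here (trans (orig-value (rep x)) (from memb≡true⇔ (All.lookup N⊆M x∈N))))
    ... | no x∉N  = here (subst (λ v → not v ≡ true) (sym (represents-loop (rep x) x∈la))
                                (from not-memb≡true⇔ x∉N))

  represents-copies : ∀ {ρ P M} → (∀ {x} → x ∈ at P → ρ (orig x) ≡ memb x M) →
                      All (ClauseSat ρ ∘ loopAxiom) la →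
                      x ∈ at P → Represents ρ M (filterᵇ (ρ ∘ copyVar la) M) x
  represents-copies {x} {ρ} {P} {M} agrees axioms x∈at = represents (agrees x∈at) copies
    where
    orig-false : x ∉ M → ρ (orig x) ≡ false
    orig-false x∉M = trans (agrees x∈at) (dec-false (x ∈? M) x∉M)

    copy-false : x ∉ M → ρ (copyVar la x) ≡ false
    copy-false x∉M with x ∈? la
    ... | no _     = orig-false x∉M
    ... | yes x∈la with All.lookup axioms x∈la
    ...   | here ¬prime    = to T-not-≡ (from T-≡ ¬prime)
    ...   | there (here o) = contradiction (trans (sym o) (orig-false x∉M)) λ ()

    copies : ρ (copyVar la x) ≡ memb x (filterᵇ (ρ ∘ copyVar la) M)
    copies with x ∈? M
    ... | yes x∈M = sym (memb-filterᵇ (ρ ∘ copyVar la) x∈M)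
    ... | no x∉M  = trans (copy-false x∉M) (sym (memb-filterᵇ-∉ (ρ ∘ copyVar la) x∉M))

pairAssignment : List ℕ → List ℕ → Assign
pairAssignment M N (orig x)  = memb x M
pairAssignment M N (prime x) = memb x N

represents-pair : ∀ {la M N} → N ⊆ M → (∀ {x} → x ∈ M → x ∉ N → x ∈ la) →
                  ∀ x → Represents {la} (pairAssignment M N) M N x
represents-pair {la} {M} {N} N⊆M unsupported⊆la x = represents refl copy
  where
  copy : pairAssignment M N (copyVar la x) ≡ memb x N
  copy with x ∈? la
  ... | yes _   = refl
  ... | no x∉la with x ∈? N
  ...   | yes x∈N = dec-true (x ∈? M) (All.lookup N⊆M x∈N)
  ...   | no x∉N  = dec-false (x ∈? M) (λ x∈M → x∉la (unsupported⊆la x∈M x∉N))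

pairAssignment-extends : Extends (τM P M) (pairAssignment M N)
pairAssignment-extends {P} (orig x) τx with memb x (at P)
pairAssignment-extends {P} (orig x) refl | true = refl

τM-at : x ∈ at P → τM P M (orig x) ≡ just (memb x M)
τM-at {x} {P} x∈at rewrite dec-true (x ∈? at P) x∈at = refl

loopClause⁻ : ∀ {ρ la} → ClauseSat ρ (loopClause M la) →
              ∃[ x ] x ∈ M × x ∈ la × not (ρ (prime x)) ≡ true
loopClause⁻ {M} {ρ} {la} sat =
  let x , x∈ , ¬prime = find (Any.map⁻ sat)
      x∈M , x∈la = ∈-filterᵇ⁻ (λ x → memb x la) {zs = M} x∈
  in x , x∈M , to memb≡true⇔ x∈la , ¬prime

loopClause⁺ : ∀ {ρ la} → x ∈ M → x ∈ la → not (ρ (prime x)) ≡ true →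
              ClauseSat ρ (loopClause M la)
loopClause⁺ x∈M x∈la ¬prime =
  Any.map⁺ (lose (∈-filterᵇ⁺ _ x∈M (from memb≡true⇔ x∈la)) ¬prime)

-- Loops in the positive dependency graph

¬¬-characteristic : (Q : ℕ → Set) (xs : List ℕ) →
                    ¬ ¬ (Σ (ℕ → Bool) λ d → ∀ {x} → x ∈ xs → d x ≡ true ⇔ Q x)
¬¬-characteristic Q []       k = k ((λ _ → false) , λ ())
¬¬-characteristic Q (x ∷ xs) k =
  ¬¬-characteristic Q xs λ (d , d-spec) → ¬¬-excluded-middle λ Qx? →
    k ((λ y → if y ==ℕ x then does Qx? else d y) , spec {d} d-spec Qx?)
  where
  spec : ∀ {d} → (∀ {y} → y ∈ xs → d y ≡ true ⇔ Q y) → (Qx? : Dec (Q x)) →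
         ∀ {y} → y ∈ x ∷ xs → (if y ==ℕ x then does Qx? else d y) ≡ true ⇔ Q y
  spec d-spec Qx? {y} y∈ with y ==ℕ x in y=x
  spec d-spec Qx? {y} y∈ | true with refl ← ≡ᵇ⇒≡ y x (from T-≡ y=x) =
    mk⇔ (λ e → decidable-stable Qx? λ ¬Qx → contradiction (trans (sym e) (dec-false Qx? ¬Qx)) λ ())
        (dec-true Qx?)
  spec d-spec Qx? (here refl)  | false = ⊥-elim (subst T y=x (≡⇒≡ᵇ x x refl))
  spec d-spec Qx? (there y∈xs) | false = d-spec y∈xs

Path-snoc : ∀ {L x a b} → Path P L x a → Edge P a b → b ∈ L → Path P L x b
Path-snoc (edge x∈L a∈L x→a) a→b b∈L = step x∈L x→a (edge a∈L b∈L a→b)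
Path-snoc (step x∈L x→z p)   a→b b∈L = step x∈L x→z (Path-snoc p a→b b∈L)

StronglyConnected : Program → List ℕ → Set
StronglyConnected P L = ∀ x y → x ∈ L → y ∈ L → Path P L x y

record Trap (P : Program) (U L : List ℕ) : Set where
  field
    trap⊆U    : L ⊆ U
    inhabited : ∃[ x ] x ∈ L
    closed    : ∀ {a b} → a ∈ L → b ∈ U → Edge P a b → b ∈ L

module _ {P : Program} {U : List ℕ} (successor : ∀ {a} → a ∈ U → ∃[ b ] b ∈ U × Edge P a b) where

  reachable-trap : ∀ {L x d} → Trap P U L → x ∈ L →
                   (∀ {y} → y ∈ L → d y ≡ true ⇔ Path P L x y) → Trap P U (filterᵇ d L)
  reachable-trap {L} {x} {d} trap x∈L d-spec = record
    { trap⊆U    = All.tabulate (All.lookup trap⊆U ∘ proj₁ ∘ ∈-filterᵇ⁻ d {zs = L})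
    ; inhabited = let s , s∈U , x→s = successor (All.lookup trap⊆U x∈L)
                      s∈L = closed x∈L s∈U x→s
                  in s , ∈-filterᵇ⁺ d s∈L (from (d-spec s∈L) (edge x∈L s∈L x→s))
    ; closed    = λ a∈ b∈U a→b → let a∈L , da = ∈-filterᵇ⁻ d {zs = L} a∈
                                     b∈L = closed a∈L b∈U a→b
                                     x→b = Path-snoc (to (d-spec a∈L) da) a→b b∈L
                                 in ∈-filterᵇ⁺ d b∈L (from (d-spec b∈L) x→b)
    }
    where open Trap trap

  -- Shrink the trap to the atoms reachable from an atom that does not reach all of it, until every
  -- atom reaches every other.  Reachability is only decided classically, hence the double negation.
  trap⇒¬¬loop : ∀ {L} → Trap P U L → ¬ ¬ (∃[ K ] Trap P U K × StronglyConnected P K)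
  trap⇒¬¬loop {L} = go L (On.wellFounded length <-wellFounded L)
    where
    go : ∀ L → Acc (_<_ on length) L → Trap P U L → ¬ ¬ (∃[ K ] Trap P U K × StronglyConnected P K)
    go L (acc smaller) trap k =
      ¬¬-characteristic (λ x → ∀ {y} → y ∈ L → Path P L x y) L λ (c , c-spec) →
      case All.all? (λ x → c x Bool.≟ true) L of λ where
        (yes all-reach) → k (L , trap , λ x y x∈L y∈L → to (c-spec x∈L) (All.lookup all-reach x∈L) y∈L)
        (no ¬all-reach) →
          let x , x∈L , ¬reach = find (All.¬All⇒Any¬ (λ x → c x Bool.≟ true) L ¬all-reach) in
          ¬¬-characteristic (Path P L x) L λ (d , d-spec) →
            let misses = All.¬All⇒Any¬ (T? ∘ d) L λ all-d → ¬reach (from (c-spec x∈L) λ y∈L →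
                           to (d-spec y∈L) (to T-≡ (All.lookup all-d y∈L)))
            in go (filterᵇ d L) (smaller (filter-notAll (T? ∘ d) L misses))
                  (reachable-trap trap x∈L d-spec) k

-- Unfounded sets

module _ {P : Program} {M N : List ℕ} (N⊆M : N ⊆ M) (N⊨ : N ⊨ reduct P M) where

  unfounded-successor : M ⊆ at P → Holds (τ M) (Comp P) → a ∈ M ∖ N → ∃[ b ] b ∈ M ∖ N × Edge P a b
  unfounded-successor M⊆atP comp a∈U with ∈-∖⁻ a∈U
  ... | a∈M , a∉N with comp⇒support M⊆atP comp a∈M
  ... | S with to (reduct-model⇔ {N} {P} {M}) N⊨ (Support.rule∈P S) (Support.neg∩M≡∅ S)
  ...   | inj₁ h = let h , h∈head , h∈N = find h in
    contradiction (subst (_∈ N) (Support.head∩M≡a S h∈head (All.lookup N⊆M h∈N)) h∈N) a∉N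
  ...   | inj₂ p = let b , b∈pos , b∉N = find p in
    b , ∈-∖⁺ (All.lookup (Support.pos⊆M S) b∈pos) b∉N
      , lose (Support.rule∈P S) (Support.a∈head S , b∈pos)

  -- If the body of a rule holds in M ∖ L but N violates it, a positive body atom b lies in M ∖ N;
  -- an edge from a head atom in L to b would put b in L, so the head atom M provides is outside L.
  trap-removal-model : M ⊨ P → ∀ {L} → Trap P (M ∖ N) L → M ∖ L ⊨ reduct P M
  trap-removal-model M⊨P {L} trap = from (reduct-model⇔ {M ∖ L} {P} {M}) removal⊨⁺
    where
    open Trap trap

    N∩L≡∅ : ∀ {h} → h ∈ N → h ∉ L
    N∩L≡∅ h∈N h∈L = proj₂ (∈-∖⁻ (All.lookup trap⊆U h∈L)) h∈N

    removal⊨⁺ : ∀ {r} → r ∈ P → All (_∉ M) (neg r) → M ∖ L ⊨⁺ r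
    removal⊨⁺ {r} r∈P ns with any? (λ b → ¬? (b ∈? M ∖ L)) (pos r)
    ... | yes p = inj₂ p
    ... | no ¬p with to (reduct-model⇔ {N} {P} {M}) N⊨ r∈P ns
    ...   | inj₁ h = inj₁ (Any.map (λ h∈N → ∈-∖⁺ (All.lookup N⊆M h∈N) (N∩L≡∅ h∈N)) h)
    ...   | inj₂ p with find p
    ...     | b , b∈pos , b∉N =
      let h , h∈head , h∈M = find (⊨r-fire (All.lookup M⊨P r∈P) (All.map (proj₁ ∘ ∈-∖⁻) ps) ns)
      in inj₁ (lose h∈head (outside-L h∈head h∈M))
      where
      ps : All (_∈ M ∖ L) (pos r)
      ps = All.map (decidable-stable (_ ∈? M ∖ L)) (All.¬Any⇒All¬ (pos r) ¬p)

      outside-L : ∀ {h} → h ∈ head r → h ∈ M → h ∈ M ∖ L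
      outside-L {h} h∈head h∈M with h ∈? L
      ... | no h∉L  = ∈-∖⁺ h∈M h∉L
      ... | yes h∈L = let b∈M , b∉L = ∈-∖⁻ (All.lookup ps b∈pos) in
        contradiction (closed h∈L (∈-∖⁺ b∈M b∉N) (lose r∈P (h∈head , b∈pos))) b∉L

module _ (P : Program) (M : List ℕ) (M⊆atP : M ⊆ at P) (la : List ℕ) where

  loopFormula : CNF
  loopFormula = UP (Copy P la) (τM P M) ++ [ loopClause M la ]

  answer-set⇒unsat : AnswerSet P M → Unsatisfiable loopFormula
  answer-set⇒unsat (M⊨P , minimal) (ρ , sat)
    with loopClause⁻ (All.head (All.++⁻ʳ (UP (Copy P la) (τM P M)) sat))
  ... | w , w∈M , w∈la , ¬prime = minimal (copied , copied⊆M , lose w∈M w∉copied , copied⊨reduct)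
    where
    σ = τM P M
    R = σ ◃ ρ
    copied = filterᵇ (R ∘ copyVar la) M

    copy-sat : SatCNF R (Copy P la)
    copy-sat = UP-sat⇒◃-sat σ ρ (Copy P la) (All.++⁻ˡ _ sat)

    rep : ∀ {x} → x ∈ at P → Represents {la} R M copied x
    rep = represents-copies {P = P} (λ x∈at → ◃-extends σ ρ (orig _) (τM-at {P = P} {M = M} x∈at))
                            (proj₁ (to (Copy-sat⇔ {la} {R} {P}) copy-sat))

    copied⊆M : copied ⊆ M
    copied⊆M = All.tabulate (proj₁ ∘ ∈-filterᵇ⁻ (R ∘ copyVar la) {zs = M})

    copied⊨reduct : copied ⊨ reduct P M
    copied⊨reduct = copy-sat⇒reduct-model M⊨P copied⊆M
      (λ x∈M → represents-unsupported (rep (All.lookup M⊆atP x∈M)) x∈M) rep copy-sat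

    -- R agrees with ρ on the copy w', which the loop clause makes false.
    w∉copied : w ∉ copied
    w∉copied w∈copied = contradiction
      (trans (represents-loop (rep (All.lookup M⊆atP w∈M)) w∈la) (from memb≡true⇔ w∈copied))
      (λ w′-true → case trans (sym (cong not w′-true)) ¬prime of λ ())

  unsat⇒answer-set : Enumerates-LA P la → Holds (τ M) (Comp P) → Unsatisfiable loopFormula → AnswerSet P M
  unsat⇒answer-set enum comp unsat = M⊨P , λ (N , N⊆M , some∉N , N⊨) →
    trap⇒¬¬loop (unfounded-successor N⊆M N⊨ M⊆atP comp) (unfounded-trap some∉N)
      λ (K , trap , connected) → loop-refutes N⊆M N⊨ trap connected
    where
    M⊨P : M ⊨ P
    M⊨P = comp⇒model comp

    unfounded-trap : ∀ {N} → Any (_∉ N) M → Trap P (M ∖ N) (M ∖ N)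
    unfounded-trap some∉N = let x , x∈M , x∉N = find some∉N in
      record { trap⊆U = All.tabulate id ; inhabited = x , ∈-∖⁺ x∈M x∉N ; closed = λ _ b∈U _ → b∈U }

    loop-refutes : ∀ {N K} → N ⊆ M → N ⊨ reduct P M → Trap P (M ∖ N) K → StronglyConnected P K → ⊥
    loop-refutes {N} {K} N⊆M N⊨ trap connected = unsat
      ( pairAssignment M (M ∖ K)
      , All.++⁺ (UP-complete pairAssignment-extends copy-sat)
                (loopClause⁺ (K⊆M w∈K) (K⊆la w∈K) w′-false ∷ []) )
      where
      open Trap trap

      K⊆M : ∀ {x} → x ∈ K → x ∈ M
      K⊆M = proj₁ ∘ ∈-∖⁻ ∘ All.lookup trap⊆U

      K⊆la : ∀ {x} → x ∈ K → x ∈ la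
      K⊆la {x} x∈K = proj₂ (enum x) (K , (All.tabulate (All.lookup M⊆atP ∘ K⊆M) , connected) , x∈K)

      unsupported⊆la : ∀ {x} → x ∈ M → x ∉ M ∖ K → x ∈ la
      unsupported⊆la {x} x∈M x∉M∖K with x ∈? K
      ... | yes x∈K = K⊆la x∈K
      ... | no x∉K  = contradiction (∈-∖⁺ x∈M x∉K) x∉M∖K

      copy-sat : SatCNF (pairAssignment M (M ∖ K)) (Copy P la)
      copy-sat = reduct-model⇒copy-sat {P = P} ∖-⊆ (represents-pair ∖-⊆ unsupported⊆la)
                   (trap-removal-model N⊆M N⊨ M⊨P trap)

      w = proj₁ inhabited
      w∈K = proj₂ inhabited

      w′-false : not (memb w (M ∖ K)) ≡ true
      w′-false = from not-memb≡true⇔ λ w∈M∖K → proj₂ (∈-∖⁻ w∈M∖K) w∈K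

lemma3 : (P : Program) (M : List ℕ) → M ⊆ at P → (la : List ℕ) → Enumerates-LA P la →
    eval (τ M) (Comp P) ≡ true →
    AnswerSet P M ⇔ Unsatisfiable (UP (Copy P la) (τM P M) ++ [ loopClause M la ])
lemma3 P M M⊆atP la enum comp =
  mk⇔ (answer-set⇒unsat P M M⊆atP la) (unsat⇒answer-set P M M⊆atP la enum comp)
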